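{- Let $n$ be even and $\mathcal{S}_{\mathrm{int}}=\{[a,a+n/2]: a=1,\ldots,n/2\}\subseteq 2^{[n]}$. Then $\mathrm{HHdim}(\mathcal{S}_{\mathrm{int}})\le3$.
   Context: Subsets are identified with $0/1$ vectors; $u\circ v$ is the coordinatewise product and $\operatorname{supp}(v)=\{i:v_i\ne0\}$. $H(\mathcal{S},v)=\{i\in[n]:\exists s\in\mathcal{S}\text{ with }\operatorname{supp}(s\circ v)=\{i\}\}$ and $\mathrm{HHdim}(\mathcal{S})=\sup_{v\in\mathbb{R}^n}|H(\mathcal{S},v)|$. $[a,b]$ denotes $\{a,a+1,\ldots,b\}$. -}

module Defs where

open import Data.Nat using (ℕ; _+_; _≤_; _≤ᵇ_)
open import Data.Bool using (Bool; true; false; _∧_; if_then_else_)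
open import Data.Fin using (Fin; toℕ)
open import Data.List using (List; length)
open import Data.List.Relation.Unary.All using (All)
open import Data.List.Relation.Unary.Unique.Propositional using (Unique)
open import Data.Product using (Σ; _×_)
open import Relation.Binary.PropositionalEquality using (_≡_)
open import Relation.Nullary using (¬_)

-- Subsets of [n] are 0/1 vectors, here Fin n → Bool (index i ∈ Fin n stands for i+1 ∈ [n]).
Subset01 : ℕ → Set
Subset01 n = Fin n → Bool

_∘ᶜ_ : {A : Set} {0# : A} {n : ℕ} → Subset01 n → (Fin n → A) → (Fin n → A)
_∘ᶜ_ {0# = 0#} s v i = if s i then v i else 0#

supp : {A : Set} (0# : A) {n : ℕ} → (Fin n → A) → Fin n → Set
supp 0# w i = ¬ (w i ≡ 0#)

SuppIsSingleton : {A : Set} (0# : A) {n : ℕ} → (Fin n → A) → Fin n → Set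
SuppIsSingleton 0# {n} w i = (j : Fin n) → (supp 0# w j → j ≡ i) × (j ≡ i → supp 0# w j)

H : {A : Set} (0# : A) {n : ℕ} {I : Set} → (I → Subset01 n) → (Fin n → A) → Fin n → Set
H {A} 0# {n} {I} F v i = Σ I (λ s → SuppIsSingleton 0# (_∘ᶜ_ {A} {0#} (F s) v) i)

CardAtMost : {n : ℕ} → (Fin n → Set) → ℕ → Set
CardAtMost {n} P k = (xs : List (Fin n)) → Unique xs → All P xs → length xs ≤ k

HHdimAtMost : (A : Set) (0# : A) {n : ℕ} {I : Set} → (I → Subset01 n) → ℕ → Set
HHdimAtMost A 0# {n} F k = (v : Fin n → A) → CardAtMost (H 0# F v) k

-- S_int for n = m + m: the intervals [a, a+m] for a = 1..m.
-- Index a' : Fin m stands for a = a'+1; 0-based index j is in [a, a+m] iff a' ≤ j ≤ a' + m.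
intervalSet : (m : ℕ) → Fin m → Subset01 (m + m)
intervalSet m a j = (toℕ a ≤ᵇ toℕ j) ∧ (toℕ j ≤ᵇ toℕ a + m)

module Submission where

open import Defs
open import Data.Bool using (true; false; T; if_then_else_)
open import Data.Bool.Properties using (T-∧)
open import Data.Empty using (⊥)
open import Data.Fin using (Fin; toℕ)
open import Data.Fin.Properties using (toℕ<n; toℕ-injective)
open import Data.List using ([]; _∷_)
open import Data.List.Relation.Unary.All using (_∷_)
open import Data.List.Relation.Unary.Unique.Propositional using (_∷_)
open import Data.Nat using (ℕ; _+_; _≤_; _<_; z≤n; s≤s)
open import Data.Nat.Properties
  using (≤ᵇ⇒≤; ≤⇒≤ᵇ; ≰⇒>; ≤-trans; <⇒≤; ≤-<-trans; <-trans; <-asym; <-cmp; m≤n+m; m≤n⇒m≤1+n)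
open import Data.Product using (Σ; _×_; _,_; proj₁; proj₂)
open import Data.Sum using (_⊎_; inj₁; inj₂)
open import Function.Bundles using (Equivalence)
open import Relation.Binary.Definitions using (tri<; tri≈; tri>)
open import Relation.Binary.PropositionalEquality using (_≢_; ≢-sym; refl; sym)
open import Relation.Nullary using (¬_)

-- Two distinct points of H(S_int, v) lie on opposite sides of n/2: the interval isolating
-- the smaller point must end before the larger one, which is therefore beyond n/2, and
-- the interval isolating the larger point must start after the smaller one, which is
-- therefore below n/2. So H(S_int, v) has at most two points.

CardAtMost-two : {n : ℕ} {P : Fin n → Set} →
                 (∀ {x y z} → x ≢ y → x ≢ z → y ≢ z → P x → P y → P z → ⊥) →
                 CardAtMost P 2
CardAtMost-two no-three []                 _ _ = z≤n
CardAtMost-two no-three (_ ∷ [])           _ _ = s≤s z≤n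
CardAtMost-two no-three (_ ∷ _ ∷ [])       _ _ = s≤s (s≤s z≤n)
CardAtMost-two no-three (_ ∷ _ ∷ _ ∷ _)
  ((x≢y ∷ x≢z ∷ _) ∷ (y≢z ∷ _) ∷ _) (px ∷ py ∷ pz ∷ _) with () ← no-three x≢y x≢z y≢z px py pz

Separates : {n : ℕ} {I : Set} → (I → Subset01 n) → Fin n → Fin n → Set
Separates {I = I} F i j = Σ I (λ s → T (F s i) × ¬ T (F s j))

module _ {A : Set} {0# : A} where

  if-nonzero : ∀ b {x : A} → (if b then x else 0#) ≢ 0# → T b × x ≢ 0#
  if-nonzero true  x≢0 = _ , x≢0
  if-nonzero false 0≢0 with () ← 0≢0 refl

  if-true-nonzero : ∀ b {x : A} → T b → x ≢ 0# → (if b then x else 0#) ≢ 0#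
  if-true-nonzero true _ x≢0 = x≢0

  module _ {n : ℕ} {I : Set} {F : I → Subset01 n} {v : Fin n → A} where

    H-nonzero : ∀ {i} → H 0# F v i → v i ≢ 0#
    H-nonzero {i} (s , single) = proj₂ (if-nonzero (F s i) (proj₂ (single i) refl))

    H-separates : ∀ {i j} → H 0# F v i → H 0# F v j → i ≢ j → Separates F i j
    H-separates {i} {j} (s , single) hj i≢j = s , s∋i , s∌j
      where
      s∋i : T (F s i)
      s∋i = proj₁ (if-nonzero (F s i) (proj₂ (single i) refl))
      s∌j : ¬ T (F s j)
      s∌j s∋j = i≢j (sym (proj₁ (single j) (if-true-nonzero (F s j) s∋j (H-nonzero hj))))

module _ (m : ℕ) where

  intervalSet-bounds : ∀ {a j} → T (intervalSet m a j) → toℕ a ≤ toℕ j × toℕ j ≤ toℕ a + m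
  intervalSet-bounds {a} {j} a∋j with lo , hi ← Equivalence.to T-∧ a∋j =
    ≤ᵇ⇒≤ (toℕ a) (toℕ j) lo , ≤ᵇ⇒≤ (toℕ j) (toℕ a + m) hi

  intervalSet-intro : ∀ {a j} → toℕ a ≤ toℕ j → toℕ j ≤ toℕ a + m → T (intervalSet m a j)
  intervalSet-intro lo hi = Equivalence.from T-∧ (≤⇒≤ᵇ lo , ≤⇒≤ᵇ hi)

  separated-from-above : ∀ {p q} → toℕ p < toℕ q → Separates (intervalSet m) p q → m < toℕ q
  separated-from-above {p} {q} p<q (a , a∋p , a∌q) =
    ≤-<-trans (m≤n+m m (toℕ a)) (≰⇒> λ q≤a+m → a∌q (intervalSet-intro a≤q q≤a+m))
    where
    a≤q : toℕ a ≤ toℕ q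
    a≤q = ≤-trans (proj₁ (intervalSet-bounds a∋p)) (<⇒≤ p<q)

  separated-from-below : ∀ {p q} → toℕ p < toℕ q → Separates (intervalSet m) q p → toℕ p < m
  separated-from-below {p} {q} p<q (b , b∋q , b∌p) =
    <-trans (≰⇒> λ b≤p → b∌p (intervalSet-intro b≤p p≤b+m)) (toℕ<n b)
    where
    p≤b+m : toℕ p ≤ toℕ b + m
    p≤b+m = ≤-trans (<⇒≤ p<q) (proj₂ (intervalSet-bounds b∋q))

  module _ {A : Set} {0# : A} (v : Fin (m + m) → A) where

    Hint : Fin (m + m) → Set
    Hint = H 0# (intervalSet m) v

    Hint-opposite-sides : ∀ {x y} → x ≢ y → Hint x → Hint y →
                          (toℕ x < m × m < toℕ y) ⊎ (toℕ y < m × m < toℕ x)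
    Hint-opposite-sides {x} {y} x≢y hx hy with <-cmp (toℕ x) (toℕ y)
    ... | tri< x<y _ _ = inj₁ (separated-from-below x<y (H-separates hy hx (≢-sym x≢y)) ,
                               separated-from-above x<y (H-separates hx hy x≢y))
    ... | tri≈ _ x≡y _ with () ← x≢y (toℕ-injective x≡y)
    ... | tri> _ _ y<x = inj₂ (separated-from-below y<x (H-separates hx hy x≢y) ,
                               separated-from-above y<x (H-separates hy hx (≢-sym x≢y)))

    Hint-no-three : ∀ {x y z} → x ≢ y → x ≢ z → y ≢ z → Hint x → Hint y → Hint z → ⊥
    Hint-no-three x≢y x≢z y≢z hx hy hz
      with Hint-opposite-sides x≢y hx hy | Hint-opposite-sides x≢z hx hz
         | Hint-opposite-sides y≢z hy hz
    ... | inj₁ (x<m , _) | inj₂ (_ , m<x) | _              = <-asym x<m m<x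
    ... | inj₂ (_ , m<x) | inj₁ (x<m , _) | _              = <-asym x<m m<x
    ... | inj₁ (_ , m<y) | inj₁ _         | inj₁ (y<m , _) = <-asym y<m m<y
    ... | inj₁ _         | inj₁ (_ , m<z) | inj₂ (z<m , _) = <-asym z<m m<z
    ... | inj₂ _         | inj₂ (z<m , _) | inj₁ (_ , m<z) = <-asym z<m m<z
    ... | inj₂ (y<m , _) | inj₂ _         | inj₂ (_ , m<y) = <-asym y<m m<y

mainTheorem13 : (A : Set) (0# : A) (m : ℕ) → HHdimAtMost A 0# (intervalSet m) 3
mainTheorem13 A 0# m v xs unique inH =
  m≤n⇒m≤1+n (CardAtMost-two (Hint-no-three m v) xs unique inH)
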